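{- Let $T,S$ be teams. The following are equivalent: (1) $T\equiv_{\mathrm{st}}S$; (2) there are surjective, non-decreasing functions $\mu,\nu:\mathbb N\to\mathbb N$ such that $T^{\mu(n)}\equiv_{\mathrm{st}}S^{\nu(n)}$ for all $n\ge0$.
   Context: A trace is an infinite sequence $t=t(0)t(1)\cdots$ of sets of propositions; $t^i=t(i)t(i+1)\cdots$. A team is a set of traces; $T^i=\{t^i\mid t\in T\}$. A stuttering function of a trace $t$ is a strictly increasing $f:\mathbb N\to\mathbb N$ with $f(0)=0$ and $t(f(k))=\cdots=t(f(k+1)-1)$ for all $k$; a stuttering function of a team is one that is a stuttering function of each of its traces. For $f:\mathbb N\to\mathbb N$, $t[f]=t(f(0))t(f(1))\cdots$ and $T[f]=\{t[f]\mid t\in T\}$. $T\equiv_{\mathrm{st}}T'$ means there are stuttering functions $f$ of $T$ and $f'$ of $T'$ with $T[f]=T'[f']$. -}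

module Defs where

open import Data.Nat using (ℕ; zero; suc; _+_; _≤_; _<_)
open import Data.Product using (Σ; ∃; _×_; _,_)
open import Relation.Binary.PropositionalEquality using (_≡_)

-- The "letters" of traces (sets of propositions) form an arbitrary type A;
-- equality of letters is propositional equality on A.
module _ (A : Set) where

  Trace : Set
  Trace = ℕ → A

  Team : Set₁
  Team = Trace → Set

_≈ᵗ_ : {A : Set} → Trace A → Trace A → Set
t ≈ᵗ u = ∀ n → t n ≡ u n

suffix : {A : Set} → Trace A → ℕ → Trace A
suffix t i n = t (i + n)

teamSuffix : {A : Set} → Team A → ℕ → Team A
teamSuffix T i u = Σ (Trace _) λ t → T t × (u ≈ᵗ suffix t i)

restrict : {A : Set} → Trace A → (ℕ → ℕ) → Trace A
restrict t f n = t (f n)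

teamRestrict : {A : Set} → Team A → (ℕ → ℕ) → Team A
teamRestrict T f u = Σ (Trace _) λ t → T t × (u ≈ᵗ restrict t f)

_≐_ : {A : Set} → Team A → Team A → Set
T ≐ S = (∀ u → T u → S u) × (∀ u → S u → T u)

StrictlyIncreasing : (ℕ → ℕ) → Set
StrictlyIncreasing f = ∀ k → f k < f (suc k)

NonDecreasing : (ℕ → ℕ) → Set
NonDecreasing f = ∀ {m n} → m ≤ n → f m ≤ f n

Surjective : (ℕ → ℕ) → Set
Surjective f = ∀ k → ∃ λ n → f n ≡ k

IsStutteringTrace : {A : Set} → Trace A → (ℕ → ℕ) → Set
IsStutteringTrace t f =
  StrictlyIncreasing f × (f 0 ≡ 0) ×
  (∀ k i → f k ≤ i → i < f (suc k) → t i ≡ t (f k))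

IsStutteringTeam : {A : Set} → Team A → (ℕ → ℕ) → Set
IsStutteringTeam T f =
  StrictlyIncreasing f × (f 0 ≡ 0) ×
  (∀ t → T t → IsStutteringTrace t f)

_≡st_ : {A : Set} → Team A → Team A → Set
T ≡st T' = Σ (ℕ → ℕ) λ f → Σ (ℕ → ℕ) λ f' →
  IsStutteringTeam T f × IsStutteringTeam T' f' ×
  (teamRestrict T f ≐ teamRestrict T' f')

-- If f and f' witness T ≡st S, then T[f] = S[f'], and the k-th letter of either side
-- is repeated throughout the k-th block [f k, f (k+1)) of f, resp. of f'. For x in
-- block k of f and y in block k of f', the suffix T^x still stutters to T[f]^k and
-- S^y to S[f']^k, so T^x ≡st S^y. Walking through the blocks of f and f' in lockstep,
-- one position per step, produces the non-decreasing surjections μ and ν.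
-- Conversely, a surjective non-decreasing function maps 0 to 0, and T^0 is T.
module Submission where

open import Defs
open import Data.Nat using (ℕ; zero; suc; _+_; _∸_; _≤_; _<_; _≤′_; ≤′-refl; ≤′-step; z≤n; s≤s; _<?_; _≤?_; _≟_)
open import Data.Nat.Properties
open import Data.Product using (Σ; ∃; _×_; _,_; proj₁; proj₂)
open import Data.Empty using (⊥-elim)
open import Relation.Nullary using (yes; no)
open import Relation.Binary.PropositionalEquality
  using (_≡_; refl; sym; trans; cong; subst; subst₂; module ≡-Reasoning)
open import Function.Bundles using (_⇔_; mk⇔)

≤-suc⇒nonDecreasing : (g : ℕ → ℕ) → (∀ n → g n ≤ g (suc n)) → NonDecreasing g
≤-suc⇒nonDecreasing g g-step m≤n = go (≤⇒≤′ m≤n)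
  where
  go : ∀ {m n} → m ≤′ n → g m ≤ g n
  go ≤′-refl = ≤-refl
  go (≤′-step m≤′n) = ≤-trans (go m≤′n) (g-step _)

strictlyIncreasing⇒nonDecreasing : (f : ℕ → ℕ) → StrictlyIncreasing f → NonDecreasing f
strictlyIncreasing⇒nonDecreasing f f-inc = ≤-suc⇒nonDecreasing f (λ n → <⇒≤ (f-inc n))

strictlyIncreasing⇒inflationary : (f : ℕ → ℕ) → StrictlyIncreasing f → ∀ n → n ≤ f n
strictlyIncreasing⇒inflationary f f-inc zero = z≤n
strictlyIncreasing⇒inflationary f f-inc (suc n) =
  <-≤-trans (s≤s (strictlyIncreasing⇒inflationary f f-inc n)) (f-inc n)

unitSteps⇒surjective : (g : ℕ → ℕ) → g 0 ≡ 0 → (∀ n → g (suc n) ≤ suc (g n)) →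
  (∀ m → ∃ λ n → m ≤ g n) → Surjective g
unitSteps⇒surjective g g0 g-step unbounded m = descend (proj₁ (unbounded m)) (proj₂ (unbounded m))
  where
  descend : ∀ n → m ≤ g n → ∃ λ n' → g n' ≡ m
  descend zero m≤g0 = zero , trans g0 (sym (n≤0⇒n≡0 (subst (m ≤_) g0 m≤g0)))
  descend (suc n) m≤g[1+n] with m ≟ g (suc n)
  ... | yes m≡ = suc n , sym m≡
  ... | no m≢ = descend n (≤-pred (≤-trans (≤∧≢⇒< m≤g[1+n] m≢) (g-step n)))

surjective∧nonDecreasing⇒0↦0 : (g : ℕ → ℕ) → Surjective g → NonDecreasing g → g 0 ≡ 0
surjective∧nonDecreasing⇒0↦0 g g-surj g-mono with g-surj 0
... | n , gn≡0 = n≤0⇒n≡0 (subst (g 0 ≤_) gn≡0 (g-mono z≤n))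

InBlock : (ℕ → ℕ) → ℕ → ℕ → Set
InBlock f k x = f k ≤ x × x < f (suc k)

module Lockstep (f f' : ℕ → ℕ) (f-inc : StrictlyIncreasing f) (f'-inc : StrictlyIncreasing f')
                (f0 : f 0 ≡ 0) (f'0 : f' 0 ≡ 0) where

  record Position : Set where
    constructor position
    field
      block left right : ℕ
      left∈ : InBlock f block left
      right∈ : InBlock f' block right
  open Position

  step : Position → Position
  step (position k x y (fk≤x , x<) (f'k≤y , y<)) with suc x <? f (suc k) | suc y <? f' (suc k)
  ... | yes 1+x< | _ = position k (suc x) y (m≤n⇒m≤1+n fk≤x , 1+x<) (f'k≤y , y<)
  ... | no _ | yes 1+y< = position k x (suc y) (fk≤x , x<) (m≤n⇒m≤1+n f'k≤y , 1+y<)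
  ... | no 1+x≮ | no 1+y≮ =
    position (suc k) (suc x) (suc y)
      (≮⇒≥ 1+x≮ , ≤-<-trans x< (f-inc (suc k))) (≮⇒≥ 1+y≮ , ≤-<-trans y< (f'-inc (suc k)))

  walk : ℕ → Position
  walk zero = position 0 0 0 (≤-reflexive f0 , subst (_< f 1) f0 (f-inc 0))
                             (≤-reflexive f'0 , subst (_< f' 1) f'0 (f'-inc 0))
  walk (suc n) = step (walk n)

  μ ν : ℕ → ℕ
  μ n = left (walk n)
  ν n = right (walk n)

  left-step : ∀ p → left p ≤ left (step p) × left (step p) ≤ suc (left p)
  left-step (position k x y _ _) with suc x <? f (suc k) | suc y <? f' (suc k)
  ... | yes _ | _ = n≤1+n x , ≤-refl
  ... | no _ | yes _ = ≤-refl , n≤1+n x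
  ... | no _ | no _ = n≤1+n x , ≤-refl

  right-step : ∀ p → right p ≤ right (step p) × right (step p) ≤ suc (right p)
  right-step (position k x y _ _) with suc x <? f (suc k) | suc y <? f' (suc k)
  ... | yes _ | _ = ≤-refl , n≤1+n y
  ... | no _ | yes _ = n≤1+n y , ≤-refl
  ... | no _ | no _ = n≤1+n y , ≤-refl

  step-progresses : ∀ p → left p + right p < left (step p) + right (step p)
  step-progresses (position k x y _ _) with suc x <? f (suc k) | suc y <? f' (suc k)
  ... | yes _ | _ = ≤-refl
  ... | no _ | yes _ = ≤-reflexive (sym (+-suc x y))
  ... | no _ | no _ = ≤-trans (n≤1+n _) (≤-reflexive (cong suc (sym (+-suc x y))))

  n≤μ+ν : ∀ n → n ≤ μ n + ν n
  n≤μ+ν zero = z≤n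
  n≤μ+ν (suc n) = ≤-trans (s≤s (n≤μ+ν n)) (step-progresses (walk n))

  -- Were the block still below m after f m + f' m steps, μ + ν would be below f m + f' m.
  block-unbounded : ∀ m → m ≤ block (walk (f m + f' m))
  block-unbounded m with walk (f m + f' m) | n≤μ+ν (f m + f' m)
  ... | position k x y (_ , x<) (_ , y<) | fm+f'm≤x+y with m ≤? k
  ...   | yes m≤k = m≤k
  ...   | no m≰k = ⊥-elim (<-irrefl refl (begin-strict
    f m + f' m              ≤⟨ fm+f'm≤x+y ⟩
    x + y                   <⟨ +-mono-< x< y< ⟩
    f (suc k) + f' (suc k)  ≤⟨ +-mono-≤ (strictlyIncreasing⇒nonDecreasing f f-inc k<m)
                                        (strictlyIncreasing⇒nonDecreasing f' f'-inc k<m) ⟩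
    f m + f' m              ∎))
    where
    open ≤-Reasoning
    k<m : k < m
    k<m = ≰⇒> m≰k

  μ-surjective : Surjective μ
  μ-surjective = unitSteps⇒surjective μ refl (λ n → proj₂ (left-step (walk n))) λ m →
    f m + f' m , ≤-trans (strictlyIncreasing⇒inflationary f f-inc m)
      (≤-trans (strictlyIncreasing⇒nonDecreasing f f-inc (block-unbounded m))
               (proj₁ (left∈ (walk (f m + f' m)))))

  ν-surjective : Surjective ν
  ν-surjective = unitSteps⇒surjective ν refl (λ n → proj₂ (right-step (walk n))) λ m →
    f m + f' m , ≤-trans (strictlyIncreasing⇒inflationary f' f'-inc m)
      (≤-trans (strictlyIncreasing⇒nonDecreasing f' f'-inc (block-unbounded m))
               (proj₁ (right∈ (walk (f m + f' m)))))

  μ-nonDecreasing : NonDecreasing μ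
  μ-nonDecreasing = ≤-suc⇒nonDecreasing μ (λ n → proj₁ (left-step (walk n)))

  ν-nonDecreasing : NonDecreasing ν
  ν-nonDecreasing = ≤-suc⇒nonDecreasing ν (λ n → proj₁ (right-step (walk n)))

lockstep : (f f' : ℕ → ℕ) → StrictlyIncreasing f → StrictlyIncreasing f' → f 0 ≡ 0 → f' 0 ≡ 0 →
  Σ (ℕ → ℕ) λ μ → Σ (ℕ → ℕ) λ ν →
    Surjective μ × NonDecreasing μ × Surjective ν × NonDecreasing ν ×
    (∀ n → ∃ λ k → InBlock f k (μ n) × InBlock f' k (ν n))
lockstep f f' f-inc f'-inc f0 f'0 =
  μ , ν , μ-surjective , μ-nonDecreasing , ν-surjective , ν-nonDecreasing ,
  λ n → block (walk n) , left∈ (walk n) , right∈ (walk n)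
  where
  open Lockstep f f' f-inc f'-inc f0 f'0
  open Position

module _ {A : Set} where

  ≐-trans : {T U V : Team A} → T ≐ U → U ≐ V → T ≐ V
  ≐-trans (T⊆U , U⊆T) (U⊆V , V⊆U) = (λ u Tu → U⊆V u (T⊆U u Tu)) , (λ u Vu → U⊆T u (V⊆U u Vu))

  ≐-sym : {T U : Team A} → T ≐ U → U ≐ T
  ≐-sym (T⊆U , U⊆T) = U⊆T , T⊆U

  teamSuffix-cong : {T S : Team A} → T ≐ S → ∀ k → teamSuffix T k ≐ teamSuffix S k
  teamSuffix-cong (T⊆S , S⊆T) k =
    (λ { u (t , Tt , u≈) → t , T⊆S t Tt , u≈ }) , (λ { u (t , St , u≈) → t , S⊆T t St , u≈ })

  isStutteringTrace-resp-≈ᵗ : {u v : Trace A} {g : ℕ → ℕ} → u ≈ᵗ v →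
    IsStutteringTrace v g → IsStutteringTrace u g
  isStutteringTrace-resp-≈ᵗ {u} {v} {g} u≈v (g-inc , g0 , v-stutters) =
    g-inc , g0 , λ m i g[m]≤i i<g[1+m] → begin
      u i      ≡⟨ u≈v i ⟩
      v i      ≡⟨ v-stutters m i g[m]≤i i<g[1+m] ⟩
      v (g m)  ≡⟨ sym (u≈v (g m)) ⟩
      u (g m)  ∎
    where open ≡-Reasoning

  teamRestrict-teamSuffix : (T : Team A) (x k : ℕ) (g f : ℕ → ℕ) →
    (∀ t → T t → restrict (suffix t x) g ≈ᵗ suffix (restrict t f) k) →
    teamRestrict (teamSuffix T x) g ≐ teamSuffix (teamRestrict T f) k
  teamRestrict-teamSuffix T x k g f pointwise =
    (λ { u (v , (t , Tt , v≈) , u≈) →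
          restrict t f , (t , Tt , λ _ → refl) , λ m → trans (u≈ m) (trans (v≈ (g m)) (pointwise t Tt m)) })
    , (λ { u (w , (t , Tt , w≈) , u≈) →
          suffix t x , (t , Tt , λ _ → refl) , λ m → trans (u≈ m) (trans (w≈ (k + m)) (sym (pointwise t Tt m))) })

  teamRestrict-teamSuffix-0 : (T : Team A) (f : ℕ → ℕ) → teamRestrict (teamSuffix T 0) f ≐ teamRestrict T f
  teamRestrict-teamSuffix-0 T f =
    (λ { u (v , (t , Tt , v≈) , u≈) → t , Tt , λ m → trans (u≈ m) (v≈ (f m)) })
    , (λ { u (t , Tt , u≈) → t , (t , Tt , λ _ → refl) , u≈ })

  isStutteringTeam-teamSuffix-0 : {T : Team A} {f : ℕ → ℕ} → IsStutteringTeam (teamSuffix T 0) f → IsStutteringTeam T f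
  isStutteringTeam-teamSuffix-0 (f-inc , f0 , stutters) = f-inc , f0 , λ t Tt → stutters t (t , Tt , λ _ → refl)

  teamSuffix-0-≡st : {T S : Team A} → teamSuffix T 0 ≡st teamSuffix S 0 → T ≡st S
  teamSuffix-0-≡st {T} {S} (f , f' , f-stutters , f'-stutters , restricts≐) =
    f , f' , isStutteringTeam-teamSuffix-0 f-stutters , isStutteringTeam-teamSuffix-0 f'-stutters ,
    ≐-trans (≐-sym (teamRestrict-teamSuffix-0 T f)) (≐-trans restricts≐ (teamRestrict-teamSuffix-0 S f'))

-- The blocks of g are those of f from the k-th on, shifted by x, the k-th one truncated to start at x.
module SuffixInBlock {A : Set} {f : ℕ → ℕ} (f-inc : StrictlyIncreasing f) {k x : ℕ} (x∈ : InBlock f k x) where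

  g : ℕ → ℕ
  g zero = 0
  g (suc m) = f (suc (k + m)) ∸ x

  x<f[1+k+m] : ∀ m → x < f (suc (k + m))
  x<f[1+k+m] m = <-≤-trans (proj₂ x∈) (strictlyIncreasing⇒nonDecreasing f f-inc (s≤s (m≤m+n k m)))

  x+g[1+m] : ∀ m → x + g (suc m) ≡ f (suc (k + m))
  x+g[1+m] m = m+[n∸m]≡n (<⇒≤ (x<f[1+k+m] m))

  g-strictlyIncreasing : StrictlyIncreasing g
  g-strictlyIncreasing zero = m<n⇒0<n∸m (x<f[1+k+m] 0)
  g-strictlyIncreasing (suc m) =
    ∸-monoˡ-< (subst (λ j → f j < f (suc (k + suc m))) (+-suc k m) (f-inc (k + suc m)))
              (<⇒≤ (x<f[1+k+m] m))

  x+g-inBlock : ∀ m i → g m ≤ i → i < g (suc m) → InBlock f (k + m) (x + i)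
  x+g-inBlock m i g[m]≤i i<g[1+m] = lower m g[m]≤i , subst (x + i <_) (x+g[1+m] m) (+-monoʳ-< x i<g[1+m])
    where
    lower : ∀ m → g m ≤ i → f (k + m) ≤ x + i
    lower zero _ = ≤-trans (≤-reflexive (cong f (+-identityʳ k))) (≤-trans (proj₁ x∈) (m≤m+n x i))
    lower (suc m) g[1+m]≤i =
      subst (_≤ x + i) (trans (x+g[1+m] m) (cong f (sym (+-suc k m)))) (+-monoʳ-≤ x g[1+m]≤i)

  module _ {t : Trace A} (t-stutters : IsStutteringTrace t f) where

    stutter : ∀ j i → InBlock f j i → t i ≡ t (f j)
    stutter j i (fj≤i , i<) = proj₂ (proj₂ t-stutters) j i fj≤i i<

    restrict-suffix : restrict (suffix t x) g ≈ᵗ suffix (restrict t f) k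
    restrict-suffix zero = begin
      t (x + 0)      ≡⟨ cong t (+-identityʳ x) ⟩
      t x            ≡⟨ stutter k x x∈ ⟩
      t (f k)        ≡⟨ cong (λ j → t (f j)) (sym (+-identityʳ k)) ⟩
      t (f (k + 0))  ∎
      where open ≡-Reasoning
    restrict-suffix (suc m) = cong t (trans (x+g[1+m] m) (cong f (sym (+-suc k m))))

    suffix-stutters : IsStutteringTrace (suffix t x) g
    suffix-stutters = g-strictlyIncreasing , refl , λ m i g[m]≤i i<g[1+m] →
      trans (stutter (k + m) (x + i) (x+g-inBlock m i g[m]≤i i<g[1+m])) (sym (restrict-suffix m))

teamSuffix-inBlock : {A : Set} {T : Team A} {f : ℕ → ℕ} {k x : ℕ} → IsStutteringTeam T f → InBlock f k x →
  Σ (ℕ → ℕ) λ g → IsStutteringTeam (teamSuffix T x) g ×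
    (teamRestrict (teamSuffix T x) g ≐ teamSuffix (teamRestrict T f) k)
teamSuffix-inBlock {T = T} {f} {k} {x} (f-inc , _ , stutters) x∈ =
  g , (g-strictlyIncreasing , refl ,
       λ { u (t , Tt , u≈) → isStutteringTrace-resp-≈ᵗ u≈ (suffix-stutters (stutters t Tt)) }) ,
  teamRestrict-teamSuffix T x k g f (λ t Tt → restrict-suffix (stutters t Tt))
  where open SuffixInBlock f-inc x∈

≡st-suffixes-inBlock : {A : Set} {T S : Team A} {f f' : ℕ → ℕ} {k x y : ℕ} →
  IsStutteringTeam T f → IsStutteringTeam S f' → teamRestrict T f ≐ teamRestrict S f' →
  InBlock f k x → InBlock f' k y → teamSuffix T x ≡st teamSuffix S y
≡st-suffixes-inBlock {k = k} f-stutters f'-stutters restricts≐ x∈ y∈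
  with teamSuffix-inBlock f-stutters x∈ | teamSuffix-inBlock f'-stutters y∈
... | g , g-stutters , T≐ | g' , g'-stutters , S≐ =
  g , g' , g-stutters , g'-stutters ,
  ≐-trans T≐ (≐-trans (teamSuffix-cong restricts≐ k) (≐-sym S≐))

SynchronisedSuffixes : {A : Set} → Team A → Team A → Set
SynchronisedSuffixes T S =
  Σ (ℕ → ℕ) λ μ → Σ (ℕ → ℕ) λ ν →
    Surjective μ × NonDecreasing μ × Surjective ν × NonDecreasing ν ×
    (∀ n → teamSuffix T (μ n) ≡st teamSuffix S (ν n))

≡st⇒synchronisedSuffixes : {A : Set} {T S : Team A} → T ≡st S → SynchronisedSuffixes T S
≡st⇒synchronisedSuffixes (f , f' , f-stutters@(f-inc , f0 , _) , f'-stutters@(f'-inc , f'0 , _) , restricts≐)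
  with lockstep f f' f-inc f'-inc f0 f'0
... | μ , ν , μ-surj , μ-mono , ν-surj , ν-mono , sameBlock =
  μ , ν , μ-surj , μ-mono , ν-surj , ν-mono , λ n →
    let (k , μn∈ , νn∈) = sameBlock n
    in ≡st-suffixes-inBlock f-stutters f'-stutters restricts≐ μn∈ νn∈

synchronisedSuffixes⇒≡st : {A : Set} {T S : Team A} → SynchronisedSuffixes T S → T ≡st S
synchronisedSuffixes⇒≡st {T = T} {S} (μ , ν , μ-surj , μ-mono , ν-surj , ν-mono , suffixes≡st) =
  teamSuffix-0-≡st (subst₂ (λ i j → teamSuffix T i ≡st teamSuffix S j)
    (surjective∧nonDecreasing⇒0↦0 μ μ-surj μ-mono) (surjective∧nonDecreasing⇒0↦0 ν ν-surj ν-mono)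
    (suffixes≡st 0))

lemma25 : {A : Set} (T S : Team A) →
    (T ≡st S) ⇔
    (Σ (ℕ → ℕ) λ μ → Σ (ℕ → ℕ) λ ν →
      Surjective μ × NonDecreasing μ × Surjective ν × NonDecreasing ν ×
      (∀ n → teamSuffix T (μ n) ≡st teamSuffix S (ν n)))
lemma25 T S = mk⇔ ≡st⇒synchronisedSuffixes synchronisedSuffixes⇒≡st
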